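{- Let $n\ge 2$ and $b\ge 1$ be integers, and for $1\le i\le n$ let $B(i):=\lceil i/b\rceil$. Let $1\le i_1<j_1\le n$ and $1\le i_2<j_2\le n$ with $i_1\le i_2$ and $\{[i_1,j_1],[i_2,j_2]\}\in E(\mathcal{I}_n)$. Then exactly one of the following holds: (1) $B(i_1)=B(i_2)$, $B(j_1)=B(j_2)$, and $i_2\le j_1$; (2) $B(i_1)<B(i_2)<B(j_1)$; (3) $B(i_1)=B(i_2)$, $i_2\le j_1$, and $B(j_1)\ne B(j_2)$; (4) $B(i_1)<B(i_2)=B(j_1)=B(j_2)$ and $i_2\le j_1$; (5) $B(i_1)<B(i_2)=B(j_1)\ne B(j_2)$ and $i_2\le j_1$. Moreover, for any $1\le i_1<j_1\le n$ and $1\le i_2<j_2\le n$ with $i_1\le i_2$ such that $(i_1,j_1,i_2,j_2)$ satisfies one of (1)–(5) (and $[i_1,j_1]\neq[i_2,j_2]$), we have $\{[i_1,j_1],[i_2,j_2]\}\in E(\mathcal{I}_n)$.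
   Context: For $n\ge 2$, $\mathcal{I}_n$ is the graph whose vertices are all integer intervals $[i,j]$ with $1\le i<j\le n$, with an edge between two distinct intervals whenever they intersect. -}

module Defs where

open import Data.Nat using (ℕ; _+_; _∸_; _≤_; _<_; NonZero)
open import Data.Nat.DivMod using (_/_)
open import Data.Product using (_×_; Σ; ∃-syntax)
open import Data.Sum using (_⊎_)
open import Relation.Nullary using (¬_)
open import Relation.Binary.PropositionalEquality using (_≡_; _≢_)

-- A vertex of 𝓘ₙ: the integer interval [i , j] with 1 ≤ i < j ≤ n,
-- represented by its endpoints (i , j).
IsVertex : ℕ → ℕ → ℕ → Set
IsVertex n i j = 1 ≤ i × i < j × j ≤ n

Intersect : ℕ → ℕ → ℕ → ℕ → Set
Intersect i₁ j₁ i₂ j₂ = ∃[ k ] ((i₁ ≤ k × k ≤ j₁) × (i₂ ≤ k × k ≤ j₂))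

-- Edge of 𝓘ₙ: two distinct vertices that intersect.
-- (Intervals are equal iff their endpoint pairs are equal.)
Edge : ℕ → ℕ → ℕ → ℕ → ℕ → Set
Edge n i₁ j₁ i₂ j₂ =
  IsVertex n i₁ j₁ × IsVertex n i₂ j₂ ×
  ¬ (i₁ ≡ i₂ × j₁ ≡ j₂) × Intersect i₁ j₁ i₂ j₂

-- Block index B(i) = ⌈ i / b ⌉ (for b ≥ 1), computed as ⌊ (i + b - 1) / b ⌋.
B : (b : ℕ) → .{{NonZero b}} → ℕ → ℕ
B b i = (i + b ∸ 1) / b

ExactlyOne₅ : Set → Set → Set → Set → Set → Set
ExactlyOne₅ P₁ P₂ P₃ P₄ P₅ =
  (P₁ ⊎ P₂ ⊎ P₃ ⊎ P₄ ⊎ P₅) ×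
  ¬ (P₁ × P₂) × ¬ (P₁ × P₃) × ¬ (P₁ × P₄) × ¬ (P₁ × P₅) ×
  ¬ (P₂ × P₃) × ¬ (P₂ × P₄) × ¬ (P₂ × P₅) ×
  ¬ (P₃ × P₄) × ¬ (P₃ × P₅) ×
  ¬ (P₄ × P₅)

module _ (b : ℕ) .{{_ : NonZero b}} (i₁ j₁ i₂ j₂ : ℕ) where
  Cond1 Cond2 Cond3 Cond4 Cond5 : Set
  Cond1 = B b i₁ ≡ B b i₂ × B b j₁ ≡ B b j₂ × i₂ ≤ j₁
  Cond2 = B b i₁ < B b i₂ × B b i₂ < B b j₁
  Cond3 = B b i₁ ≡ B b i₂ × i₂ ≤ j₁ × B b j₁ ≢ B b j₂
  Cond4 = B b i₁ < B b i₂ × B b i₂ ≡ B b j₁ × B b j₁ ≡ B b j₂ × i₂ ≤ j₁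
  Cond5 = B b i₁ < B b i₂ × B b i₂ ≡ B b j₁ × B b j₁ ≢ B b j₂ × i₂ ≤ j₁

{-# OPTIONS --safe #-}
module Submission where

-- Two intervals [i₁,j₁], [i₂,j₂] with i₁ ≤ i₂ meet exactly when i₂ ≤ j₁.
-- Since B is monotone, i₁ ≤ i₂ ≤ j₁ gives B(i₁) ≤ B(i₂) ≤ B(j₁); splitting
-- both inequalities into < and =, and B(j₁) = B(j₂) or not, yields the five
-- cases, which are pairwise exclusive because each pair disagrees on one of
-- these three comparisons. Conversely every case forces i₂ ≤ j₁: directly,
-- or in case (2) because B(i₂) < B(j₁) is impossible when j₁ < i₂.

open import Defs
open import Data.Nat using (ℕ; _≤_; _<_; NonZero)
open import Data.Nat.Properties
  using (≤-refl; ≤-trans; <⇒≤; <⇒≢; <⇒≱; ≰⇒>; m≤n⇒m<n∨m≡n; _≟_; ∸-monoˡ-≤; +-monoˡ-≤)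
open import Data.Nat.DivMod using (/-monoˡ-≤)
open import Data.Product using (_×_; _,_)
open import Data.Sum using (_⊎_; inj₁; inj₂)
open import Relation.Nullary using (¬_; yes; no)
open import Relation.Binary.PropositionalEquality using (_≡_)

private
  variable
    x y i₁ j₁ i₂ j₂ : ℕ

Intersect⇒≤ : Intersect i₁ j₁ i₂ j₂ → i₂ ≤ j₁
Intersect⇒≤ (_ , (_ , k≤j₁) , (i₂≤k , _)) = ≤-trans i₂≤k k≤j₁

≤⇒Intersect : i₁ ≤ i₂ → i₂ ≤ j₁ → i₂ ≤ j₂ → Intersect i₁ j₁ i₂ j₂
≤⇒Intersect {i₂ = i₂} i₁≤i₂ i₂≤j₁ i₂≤j₂ = i₂ , (i₁≤i₂ , i₂≤j₁) , (≤-refl , i₂≤j₂)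

module _ (b : ℕ) .{{_ : NonZero b}} where

  B-mono-≤ : x ≤ y → B b x ≤ B b y
  B-mono-≤ {x} x≤y = /-monoˡ-≤ b (∸-monoˡ-≤ 1 (+-monoˡ-≤ b x≤y))

  B-cancel-< : B b x < B b y → x < y
  B-cancel-< Bx<By = ≰⇒> (λ y≤x → <⇒≱ Bx<By (B-mono-≤ y≤x))

module _ (b : ℕ) .{{_ : NonZero b}} (i₁ j₁ i₂ j₂ : ℕ) where

  AnyCond : Set
  AnyCond = Cond1 b i₁ j₁ i₂ j₂ ⊎ Cond2 b i₁ j₁ i₂ j₂ ⊎ Cond3 b i₁ j₁ i₂ j₂
    ⊎ Cond4 b i₁ j₁ i₂ j₂ ⊎ Cond5 b i₁ j₁ i₂ j₂

  AnyCond-intro : B b i₁ ≤ B b i₂ → B b i₂ ≤ B b j₁ → i₂ ≤ j₁ → AnyCond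
  AnyCond-intro Bi₁≤Bi₂ Bi₂≤Bj₁ i₂≤j₁
    with m≤n⇒m<n∨m≡n Bi₁≤Bi₂ | m≤n⇒m<n∨m≡n Bi₂≤Bj₁ | B b j₁ ≟ B b j₂
  ... | inj₂ Bi₁≡Bi₂ | _ | yes Bj₁≡Bj₂ = inj₁ (Bi₁≡Bi₂ , Bj₁≡Bj₂ , i₂≤j₁)
  ... | inj₂ Bi₁≡Bi₂ | _ | no Bj₁≢Bj₂ = inj₂ (inj₂ (inj₁ (Bi₁≡Bi₂ , i₂≤j₁ , Bj₁≢Bj₂)))
  ... | inj₁ Bi₁<Bi₂ | inj₁ Bi₂<Bj₁ | _ = inj₂ (inj₁ (Bi₁<Bi₂ , Bi₂<Bj₁))
  ... | inj₁ Bi₁<Bi₂ | inj₂ Bi₂≡Bj₁ | yes Bj₁≡Bj₂ =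
    inj₂ (inj₂ (inj₂ (inj₁ (Bi₁<Bi₂ , Bi₂≡Bj₁ , Bj₁≡Bj₂ , i₂≤j₁))))
  ... | inj₁ Bi₁<Bi₂ | inj₂ Bi₂≡Bj₁ | no Bj₁≢Bj₂ =
    inj₂ (inj₂ (inj₂ (inj₂ (Bi₁<Bi₂ , Bi₂≡Bj₁ , Bj₁≢Bj₂ , i₂≤j₁))))

  AnyCond⇒≤ : AnyCond → i₂ ≤ j₁
  AnyCond⇒≤ (inj₁ (_ , _ , i₂≤j₁)) = i₂≤j₁
  AnyCond⇒≤ (inj₂ (inj₁ (_ , Bi₂<Bj₁))) = <⇒≤ (B-cancel-< b Bi₂<Bj₁)
  AnyCond⇒≤ (inj₂ (inj₂ (inj₁ (_ , i₂≤j₁ , _)))) = i₂≤j₁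
  AnyCond⇒≤ (inj₂ (inj₂ (inj₂ (inj₁ (_ , _ , _ , i₂≤j₁))))) = i₂≤j₁
  AnyCond⇒≤ (inj₂ (inj₂ (inj₂ (inj₂ (_ , _ , _ , i₂≤j₁))))) = i₂≤j₁

  AnyCond⇒ExactlyOne : AnyCond →
    ExactlyOne₅ (Cond1 b i₁ j₁ i₂ j₂) (Cond2 b i₁ j₁ i₂ j₂)
      (Cond3 b i₁ j₁ i₂ j₂) (Cond4 b i₁ j₁ i₂ j₂) (Cond5 b i₁ j₁ i₂ j₂)
  AnyCond⇒ExactlyOne any =
    any ,
    (λ { ((eq , _) , (lt , _)) → <⇒≢ lt eq }) ,
    (λ { ((_ , eq , _) , (_ , _ , ne)) → ne eq }) ,
    (λ { ((eq , _) , (lt , _)) → <⇒≢ lt eq }) ,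
    (λ { ((eq , _) , (lt , _)) → <⇒≢ lt eq }) ,
    (λ { ((lt , _) , (eq , _)) → <⇒≢ lt eq }) ,
    (λ { ((_ , lt) , (_ , eq , _)) → <⇒≢ lt eq }) ,
    (λ { ((_ , lt) , (_ , eq , _)) → <⇒≢ lt eq }) ,
    (λ { ((eq , _) , (lt , _)) → <⇒≢ lt eq }) ,
    (λ { ((eq , _) , (lt , _)) → <⇒≢ lt eq }) ,
    (λ { ((_ , _ , eq , _) , (_ , _ , ne , _)) → ne eq })

lemma20 : (n b : ℕ) → 2 ≤ n → .{{_ : NonZero b}} →
    ((i₁ j₁ i₂ j₂ : ℕ) → i₁ ≤ i₂ → Edge n i₁ j₁ i₂ j₂ →
      ExactlyOne₅ (Cond1 b i₁ j₁ i₂ j₂) (Cond2 b i₁ j₁ i₂ j₂)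
        (Cond3 b i₁ j₁ i₂ j₂) (Cond4 b i₁ j₁ i₂ j₂) (Cond5 b i₁ j₁ i₂ j₂))
    ×
    ((i₁ j₁ i₂ j₂ : ℕ) → IsVertex n i₁ j₁ → IsVertex n i₂ j₂ → i₁ ≤ i₂ →
      ¬ (i₁ ≡ i₂ × j₁ ≡ j₂) →
      (Cond1 b i₁ j₁ i₂ j₂ ⊎ Cond2 b i₁ j₁ i₂ j₂ ⊎ Cond3 b i₁ j₁ i₂ j₂
        ⊎ Cond4 b i₁ j₁ i₂ j₂ ⊎ Cond5 b i₁ j₁ i₂ j₂) →
      Edge n i₁ j₁ i₂ j₂)
lemma20 n b _ =
  (λ i₁ j₁ i₂ j₂ i₁≤i₂ (_ , _ , _ , meet) →
    let i₂≤j₁ = Intersect⇒≤ meet in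
    AnyCond⇒ExactlyOne b i₁ j₁ i₂ j₂
      (AnyCond-intro b i₁ j₁ i₂ j₂ (B-mono-≤ b i₁≤i₂) (B-mono-≤ b i₂≤j₁) i₂≤j₁)) ,
  (λ i₁ j₁ i₂ j₂ v₁ v₂@(_ , i₂<j₂ , _) i₁≤i₂ distinct any →
    v₁ , v₂ , distinct , ≤⇒Intersect i₁≤i₂ (AnyCond⇒≤ b i₁ j₁ i₂ j₂ any) (<⇒≤ i₂<j₂))
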